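{- Let $d\ge1$. Up to isomorphism of the removed complex $\Diamond(\Gamma)$, there are exactly $2^{d+1}-1$ combinatorially different basic cross-flips in dimension $d$; that is, among the complexes $\Diamond(\Gamma)$, where $\Gamma$ ranges over the $d$-balls $\Gamma\subsetneq\partial\sigma^{d+1}$ that are pure $d$-dimensional subcomplexes, there are exactly $2^{d+1}-1$ isomorphism classes.
   Context: $\sigma^{d+1}$ is the simplex on $\{0,\dots,d+1\}$. For a pure $d$-dimensional subcomplex $\Gamma\subseteq\partial\sigma^{d+1}$, $\Diamond(\Gamma)$ is obtained by, for $i=0,1,\dots,d$ in this order, stellarly subdividing the current complex $K$ at $F_i=\{i+1,\dots,d+1\}$ whenever $F_i\in K$, i.e. replacing $K$ by $(K\setminus F_i)\cup(\langle v_i\rangle*\partial F_i*\mathrm{lk}_K(F_i))$ with new vertex $v_i$. $\Diamond(\Gamma)$ is a subcomplex of the boundary $\mathcal{C}_d$ of the $(d+1)$-dimensional cross-polytope on $\{0,\dots,d\}\cup\{v_0,\dots,v_d\}$. A basic cross-flip $\chi^*_{\Diamond(\Gamma)}$ ($\Gamma\subsetneq\partial\sigma^{d+1}$ a $d$-ball) replaces, in a balanced $d$-complex $\Delta$, an induced subcomplex $D\cong\Diamond(\Gamma)$ by $\mathcal{C}_d\setminus D$ (the complex generated by the facets of $\mathcal{C}_d$ not in $D$): $\chi^*_D(\Delta)=(\Delta\setminus D)\cup(\mathcal{C}_d\setminus D)$. Two basic cross-flips are combinatorially the same when the complexes $\Diamond(\Gamma)$ they remove are isomorphic. -}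

module Defs where

open import Data.Nat using (ℕ; zero; suc; _+_)
open import Data.Nat.Properties using (_<?_)
open import Data.Fin using (Fin; toℕ; _↑ˡ_; _↑ʳ_; splitAt)
open import Data.Fin.Subset using (Subset; _∈_; _∉_; _⊆_; _⊂_; _∪_; _∩_; ⁅_⁆)
  renaming (⊥ to ∅)
open import Data.Fin.Permutation using (Permutation′; _⟨$⟩ˡ_)
open import Data.Vec using (tabulate; lookup)
open import Data.List using (foldl; allFin)
open import Data.Bool using (Bool; false)
open import Data.Sum using (_⊎_; [_,_])
open import Data.Product using (_×_; ∃; ∃-syntax)
open import Relation.Nullary using (¬_)
open import Relation.Nullary.Decidable using (⌊_⌋)
open import Relation.Binary.PropositionalEquality using (_≡_)

Cx : ℕ → Set₁
Cx N = Subset N → Set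

Link : ∀ {N} → Cx N → Subset N → Cx N
Link K F C = (C ∩ F ≡ ∅) × K (C ∪ F)

-- Stellar subdivision of K at F with (fresh) new vertex v:
-- (K ∖ F) ∪ (⟨v⟩ * ∂F * lk_K F), where K ∖ F = faces of K not containing F,
-- ⟨v⟩ = {∅,{v}}, ∂F = proper subsets of F.
-- If F ∉ K then lk_K F is empty and this returns K unchanged.
Stellar : ∀ {N} → Subset N → Fin N → Cx N → Cx N
Stellar F v K σ =
  (K σ × ¬ (F ⊆ σ))
  ⊎ ∃[ A ] ∃[ B ] ∃[ C ] (A ⊆ ⁅ v ⁆ × B ⊂ F × Link K F C × σ ≡ (A ∪ B) ∪ C)

-- Ambient vertex set for dimension d: original vertices 0..d+1 of σ^{d+1}
-- (embedded as  k ↑ˡ (d+1) ) followed by new vertices v_0..v_d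
-- (embedded as  (d+2) ↑ʳ i ).
Amb : ℕ → ℕ
Amb d = suc (suc d) + suc d

orig : ∀ d → Fin (suc (suc d)) → Fin (Amb d)
orig d k = k ↑ˡ suc d

newv : ∀ d → Fin (suc d) → Fin (Amb d)
newv d i = suc (suc d) ↑ʳ i

-- F_i = {i+1, …, d+1}
Fset : ∀ d → Fin (suc d) → Subset (Amb d)
Fset d i = tabulate (λ x → [ (λ k → ⌊ toℕ i <? toℕ k ⌋) , (λ _ → false) ]
                            (splitAt (suc (suc d)) x))

-- Γ given by the set T ⊆ {0..d+1} of facets of ∂σ^{d+1} it contains
-- (facet j = {0..d+1} ∖ {j}); Γ is the complex generated by those facets.
Gamma : ∀ d → Subset (suc (suc d)) → Cx (Amb d)
Gamma d T σ = (∀ i → newv d i ∉ σ) × ∃[ j ] (j ∈ T × orig d j ∉ σ)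

-- Γ is a nonempty proper pure d-dimensional subcomplex of ∂σ^{d+1}
-- (equivalently, a d-ball Γ ⊊ ∂σ^{d+1}).
Admissible : ∀ {n} → Subset n → Set
Admissible T = (∃[ j ] j ∈ T) × (∃[ j ] j ∉ T)

Diamond : ∀ d → Subset (suc (suc d)) → Cx (Amb d)
Diamond d T = foldl (λ K i → Stellar (Fset d i) (newv d i) K) (Gamma d T) (allFin (suc d))

img : ∀ {N} → Permutation′ N → Subset N → Subset N
img π σ = tabulate (λ y → lookup σ (π ⟨$⟩ˡ y))

Iso : ∀ {N} → Cx N → Cx N → Set
Iso {N} K L = ∃[ π ] ∀ (σ : Subset N) → (K σ → L (img π σ)) × (L (img π σ) → K σ)

-- Following the subdivisions one at a time shows that a set σ of vertices of the cross-polytope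
-- (vertices 0, …, d+1 and v_0, …, v_d, with i and v_i antipodal) is a face of ◇(Γ) exactly when
-- it avoids d+1, contains no antipodal pair, and for some facet {0, …, d+1} ∖ {j} of Γ omits j
-- and every v_i with i < j. If the facet opposite d+1 lies in Γ, let m be the largest index whose
-- facet does not: transposing m and v_m turns ◇(Γ) into ◇(Γ′), where Γ′ keeps the facets of Γ
-- below m and trades those above m for the one opposite m. So we may assume that the facet
-- opposite d+1 is not in Γ, and then Γ is a nonzero word bs ∈ {0,1}^(d+1). The facets of ◇(Γ)
-- are coded by the words w whose first 1 sits at a 1 of bs; there are exactly value bs of them,
-- bs read as a binary numeral. Isomorphisms preserve the number of facets, so the 2^(d+1) − 1
-- nonzero words give pairwise non-isomorphic complexes, and every ◇(Γ) is isomorphic to one of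
-- them.

module Submission where

open import Data.Bool using (Bool; true; false; if_then_else_)
open import Data.Bool.Properties using (T-≡)
open import Data.Empty using (⊥; ⊥-elim)
open import Data.Fin as F using (Fin; zero; suc; toℕ; inject₁; fromℕ; fromℕ<; splitAt)
open import Data.Fin.Permutation as Perm using (Permutation′; _⟨$⟩ˡ_)
import Data.Fin.Permutation.Components as PC
open import Data.Fin.Properties
  using (injective⇒≤; toℕ-fromℕ<; toℕ-injective; toℕ-inject₁; toℕ<n; toℕ-fromℕ; toℕ-inject;
         ¬∀⟶∃¬; ¬∀⟶∃¬-smallest; all?;
         splitAt-↑ˡ; splitAt-↑ʳ; splitAt⁻¹-↑ˡ; splitAt⁻¹-↑ʳ; ↑ˡ-injective; ↑ʳ-injective)
open import Data.Fin.Relation.Unary.Top using (view; ‵fromℕ; ‵inject₁)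
open import Data.Fin.Subset using (Subset; _∈_; _∉_; _⊆_; _⊂_; _∪_; _∩_; ∁; ⁅_⁆)
  renaming (⊥ to ∅)
open import Data.Fin.Subset.Properties
  using (_∈?_; x∈⁅x⁆; x∈⁅y⁆⇒x≡y; x∈p∪q⁺; x∈p∪q⁻; x∈p∩q⁺; x∈p∩q⁻; p∩q⊆p; p∩q⊆q;
         x∈∁p⇒x∉p; x∉p⇒x∈∁p; drop-there; ⊆-antisym; Empty-unique; ∉⊥)
open import Data.List using (foldl) renaming (tabulate to tabulateList)
open import Data.Nat as ℕ using (ℕ; zero; suc; _+_; _∸_; _^_; _≤_; _<_; z≤n; s≤s)
open import Data.Nat.Properties
  using (_<?_; _≤?_; <-cmp; +-identityʳ; +-suc; +-cancelˡ-≡; +-cancelˡ-<; +-mono-≤-<; m+[n∸m]≡n;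
         m≤m+n; m≤n+m; ∸-monoˡ-<; n<1⇒n≡0; n<1+n; suc-injective; ≤-refl; ≤-reflexive; ≤-trans;
         ≤-antisym; ≤-pred; <-irrefl; <-trans; <-≤-trans; <⇒≤; <⇒≢; <⇒≱; ≤⇒≯; ≮⇒≥; ≰⇒>; ≤∧≢⇒<)
open import Data.Product using (Σ; _×_; _,_; proj₁; proj₂; ∃-syntax)
open import Data.Sum using (_⊎_; inj₁; inj₂; [_,_])
open import Data.Vec using (Vec; []; _∷_; here; there; initLast; lookup; tabulate; _∷ʳ_)
open import Data.Vec.Properties
  using (∷-injectiveˡ; ∷-injectiveʳ; tabulate-cong; lookup∘tabulate; tabulate∘lookup;
         []=⇒lookup; lookup⇒[]=)
open import Defs
open import Function using (_∘_; _⇔_; mk⇔; Equivalence)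
open import Level using (Level)
open import Relation.Binary.Definitions using (tri<; tri≈; tri>)
open import Relation.Binary.PropositionalEquality
  using (_≡_; _≢_; refl; sym; trans; cong; cong₂; subst; module ≡-Reasoning)
open import Relation.Nullary using (¬_; yes; no; contradiction)
open import Relation.Nullary.Decidable
  using (⌊_⌋; dec-true; dec-false; fromWitness; toWitness; _→-dec_; decidable-stable)
open import Relation.Unary using (Pred; Decidable; _≐_)
open import Relation.Unary.Properties using (≐-sym; ≐-trans)

private
  variable
    ℓ : Level
    n : ℕ

minimal-counterexample : ∀ {P : Pred (Fin n) ℓ} → Decidable P → ¬ (∀ i → P i) →
                         ∃[ i ] (¬ P i × ∀ j → j F.< i → P j)
minimal-counterexample {P = P} P? ¬∀P with ¬∀⟶∃¬-smallest _ P P? ¬∀P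
... | i , ¬Pi , below = i , ¬Pi , λ j j<i →
  subst P (toℕ-injective (trans (toℕ-inject (fromℕ< j<i)) (toℕ-fromℕ< j<i))) (below (fromℕ< j<i))

maximal-counterexample : ∀ {P : Pred (Fin n) ℓ} → Decidable P → ¬ (∀ i → P i) →
                         ∃[ i ] (¬ P i × ∀ j → i F.< j → P j)
maximal-counterexample {zero} P? ¬∀P = contradiction (λ ()) ¬∀P
maximal-counterexample {suc n} P? ¬∀P with all? (P? ∘ suc)
... | yes ∀Ps = zero , (λ P0 → ¬∀P λ { zero → P0 ; (suc i) → ∀Ps i }) , λ { (suc j) _ → ∀Ps j }
... | no ¬∀Ps with maximal-counterexample (P? ∘ suc) ¬∀Ps
...   | i , ¬Pi , above = suc i , ¬Pi , λ { (suc j) (s≤s i<j) → above j i<j }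

lookup⇒∈ : ∀ {p : Subset n} {x} → lookup p x ≡ true → x ∈ p
lookup⇒∈ = lookup⇒[]= _ _

∈⇒lookup : ∀ {p : Subset n} {x} → x ∈ p → lookup p x ≡ true
∈⇒lookup = []=⇒lookup

lookup≡⇒∈⇔ : ∀ {m} {p : Subset m} {q : Subset n} {x y} → lookup p x ≡ lookup q y → x ∈ p ⇔ y ∈ q
lookup≡⇒∈⇔ eq = mk⇔ (lookup⇒∈ ∘ trans (sym eq) ∘ ∈⇒lookup) (lookup⇒∈ ∘ trans eq ∘ ∈⇒lookup)

lookup-∷ʳ-inject₁ : ∀ {A : Set} (xs : Vec A n) x i → lookup (xs ∷ʳ x) (inject₁ i) ≡ lookup xs i
lookup-∷ʳ-inject₁ (y ∷ xs) x zero = refl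
lookup-∷ʳ-inject₁ (y ∷ xs) x (suc i) = lookup-∷ʳ-inject₁ xs x i

lookup-∷ʳ-fromℕ : ∀ {A : Set} (xs : Vec A n) x → lookup (xs ∷ʳ x) (fromℕ n) ≡ x
lookup-∷ʳ-fromℕ [] x = refl
lookup-∷ʳ-fromℕ (y ∷ xs) x = lookup-∷ʳ-fromℕ xs x

∈-∷ʳ-inject₁ : ∀ {p : Subset n} {b i} → inject₁ i ∈ p ∷ʳ b ⇔ i ∈ p
∈-∷ʳ-inject₁ {p = p} {b} {i} = lookup≡⇒∈⇔ (lookup-∷ʳ-inject₁ p b i)

fromℕ∉∷ʳfalse : ∀ {p : Subset n} → fromℕ n ∉ p ∷ʳ false
fromℕ∉∷ʳfalse {p = p} n∈ with trans (sym (lookup-∷ʳ-fromℕ p false)) (∈⇒lookup n∈)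
... | ()

fromℕ∈∷ʳtrue : ∀ {p : Subset n} → fromℕ n ∈ p ∷ʳ true
fromℕ∈∷ʳtrue {p = p} = lookup⇒∈ (lookup-∷ʳ-fromℕ p true)

⊈⇒∃∉ : ∀ {p q : Subset n} → ¬ (p ⊆ q) → ∃[ x ] (x ∈ p × x ∉ q)
⊈⇒∃∉ {p = p} {q} p⊈q with ¬∀⟶∃¬ _ _ (λ x → (x ∈? p) →-dec (x ∈? q)) (λ p⊆q → p⊈q (p⊆q _))
... | x , ¬[x∈p⇒x∈q] = x , decidable-stable (x ∈? p) (λ x∉p → ¬[x∈p⇒x∈q] (⊥-elim ∘ x∉p))
                         , λ x∈q → ¬[x∈p⇒x∈q] (λ _ → x∈q)

∩-partition : ∀ (p q r : Subset n) → p ≡ ((p ∩ q) ∪ (p ∩ r)) ∪ (p ∩ ∁ (q ∪ r))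
∩-partition p q r = ⊆-antisym ⊆-parts parts-⊆
  where
  ⊆-parts : p ⊆ ((p ∩ q) ∪ (p ∩ r)) ∪ (p ∩ ∁ (q ∪ r))
  ⊆-parts {x} x∈p with x ∈? q | x ∈? r
  ... | yes x∈q | _ = x∈p∪q⁺ (inj₁ (x∈p∪q⁺ (inj₁ (x∈p∩q⁺ (x∈p , x∈q)))))
  ... | no _ | yes x∈r = x∈p∪q⁺ (inj₁ (x∈p∪q⁺ (inj₂ (x∈p∩q⁺ (x∈p , x∈r)))))
  ... | no x∉q | no x∉r =
    x∈p∪q⁺ (inj₂ (x∈p∩q⁺ (x∈p , x∉p⇒x∈∁p λ x∈q∪r → [ x∉q , x∉r ] (x∈p∪q⁻ q r x∈q∪r))))
  parts-⊆ : ((p ∩ q) ∪ (p ∩ r)) ∪ (p ∩ ∁ (q ∪ r)) ⊆ p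
  parts-⊆ x∈parts with x∈p∪q⁻ _ _ x∈parts
  ... | inj₂ x∈rest = p∩q⊆p _ _ x∈rest
  ... | inj₁ x∈qr = [ p∩q⊆p _ _ , p∩q⊆p _ _ ] (x∈p∪q⁻ _ _ x∈qr)

∩-∁-∪-disjoint : ∀ (p q r : Subset n) → (p ∩ ∁ (q ∪ r)) ∩ r ≡ ∅
∩-∁-∪-disjoint p q r = Empty-unique λ (x , x∈) →
  x∈∁p⇒x∉p (proj₂ (x∈p∩q⁻ p _ (proj₁ (x∈p∩q⁻ _ r x∈)))) (x∈p∪q⁺ (inj₂ (proj₂ (x∈p∩q⁻ _ r x∈))))

transpose-matchˡ : ∀ (i j : Fin n) → PC.transpose i j i ≡ j
transpose-matchˡ i j rewrite dec-true (i F.≟ i) refl = refl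

transpose-matchʳ : ∀ (i j : Fin n) → PC.transpose i j j ≡ i
transpose-matchʳ i j with j F.≟ i
... | yes refl = refl
... | no _ rewrite dec-true (j F.≟ j) refl = refl

transpose-other : ∀ {i j k : Fin n} → k ≢ i → k ≢ j → PC.transpose i j k ≡ k
transpose-other {i = i} {j} {k} k≢i k≢j rewrite dec-false (k F.≟ i) k≢i | dec-false (k F.≟ j) k≢j = refl

∈-cone⁻ : ∀ {A B C σ : Subset n} {v} → A ⊆ ⁅ v ⁆ → σ ≡ (A ∪ B) ∪ C →
          ∀ {x} → x ∈ σ → x ≡ v ⊎ x ∈ B ⊎ x ∈ C
∈-cone⁻ A⊆v σ≡ x∈σ with x∈p∪q⁻ _ _ (subst (_ ∈_) σ≡ x∈σ)
... | inj₂ x∈C = inj₂ (inj₂ x∈C)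
... | inj₁ x∈A∪B = [ inj₁ ∘ x∈⁅y⁆⇒x≡y _ ∘ A⊆v , inj₂ ∘ inj₁ ] (x∈p∪q⁻ _ _ x∈A∪B)

Stellar-cong : ∀ {N} (F : Subset N) v {K L : Cx N} → K ≐ L → Stellar F v K ≐ Stellar F v L
Stellar-cong F v (K⊆L , L⊆K) = transport K⊆L , transport L⊆K
  where
  transport : ∀ {K L : Cx _} → (∀ {σ} → K σ → L σ) → ∀ {σ} → Stellar F v K σ → Stellar F v L σ
  transport K⊆L (inj₁ (Kσ , F⊈σ)) = inj₁ (K⊆L Kσ , F⊈σ)
  transport K⊆L (inj₂ (A , B , C , A⊆v , B⊂F , (C∩F≡∅ , KC∪F) , σ≡)) =
    inj₂ (A , B , C , A⊆v , B⊂F , (C∩F≡∅ , K⊆L KC∪F) , σ≡)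

-- The vertices of the ambient cross-polytope

module _ {d : ℕ} where

  data Vertex : Fin (Amb d) → Set where
    old : ∀ k → Vertex (orig d k)
    new : ∀ i → Vertex (newv d i)

  vertex : ∀ x → Vertex x
  vertex x with splitAt (suc (suc d)) x in eq
  ... | inj₁ k = subst Vertex (splitAt⁻¹-↑ˡ eq) (old k)
  ... | inj₂ i = subst Vertex (splitAt⁻¹-↑ʳ eq) (new i)

  orig≢newv : ∀ k i → orig d k ≢ newv d i
  orig≢newv k i eq with trans (sym (splitAt-↑ˡ _ k _)) (trans (cong (splitAt _) eq) (splitAt-↑ʳ _ _ i))
  ... | ()

  orig-injective : ∀ {k l} → orig d k ≡ orig d l → k ≡ l
  orig-injective = ↑ˡ-injective _ _ _

  newv-injective : ∀ {i j} → newv d i ≡ newv d j → i ≡ j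
  newv-injective = ↑ʳ-injective _ _ _

  top : Fin (suc (suc d))
  top = fromℕ (suc d)

  vertexSet : (Fin (suc (suc d)) → Bool) → (Fin (suc d) → Bool) → Subset (Amb d)
  vertexSet f g = tabulate (λ x → [ f , g ] (splitAt (suc (suc d)) x))

  lookup-vertexSet-orig : ∀ f g k → lookup (vertexSet f g) (orig d k) ≡ f k
  lookup-vertexSet-orig f g k =
    trans (lookup∘tabulate (λ x → [ f , g ] (splitAt (suc (suc d)) x)) (orig d k))
          (cong [ f , g ] (splitAt-↑ˡ _ k _))

  lookup-vertexSet-newv : ∀ f g i → lookup (vertexSet f g) (newv d i) ≡ g i
  lookup-vertexSet-newv f g i =
    trans (lookup∘tabulate (λ x → [ f , g ] (splitAt (suc (suc d)) x)) (newv d i))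
          (cong [ f , g ] (splitAt-↑ʳ _ _ i))

  lookup-Fset-orig : ∀ i l → lookup (Fset d i) (orig d l) ≡ ⌊ toℕ i <? toℕ l ⌋
  lookup-Fset-orig i = lookup-vertexSet-orig (λ l → ⌊ toℕ i <? toℕ l ⌋) (λ _ → false)

  orig∈Fset⁺ : ∀ {i l} → toℕ i < toℕ l → orig d l ∈ Fset d i
  orig∈Fset⁺ {i} {l} i<l = lookup⇒∈ (trans (lookup-Fset-orig i l) (Equivalence.to T-≡ (fromWitness i<l)))

  orig∈Fset⁻ : ∀ {i l} → orig d l ∈ Fset d i → toℕ i < toℕ l
  orig∈Fset⁻ {i} {l} l∈F =
    toWitness (Equivalence.from T-≡ (trans (sym (lookup-Fset-orig i l)) (∈⇒lookup l∈F)))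

  newv∉Fset : ∀ {i j} → newv d j ∉ Fset d i
  newv∉Fset {j = j} j∈F with trans (sym (lookup-vertexSet-newv _ _ j)) (∈⇒lookup j∈F)
  ... | ()

-- The faces of ◇(Γ)

module _ {d : ℕ} where

  Reaches : Subset (suc (suc d)) → Subset (Amb d) → Set
  Reaches T σ = ∃[ j ] (j ∈ T × orig d j ∉ σ × ∀ i → toℕ i < toℕ j → newv d i ∉ σ)

  -- The faces of the complex obtained from Γ by subdividing at F_0, …, F_(k-1).
  record Stage (T : Subset (suc (suc d))) (k : ℕ) (σ : Subset (Amb d)) : Set where
    constructor stage
    field
      unborn    : ∀ i → k ≤ toℕ i → newv d i ∉ σ
      antipodal : ∀ i → toℕ i < k → orig d (inject₁ i) ∈ σ → newv d i ∉ σ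
      reaches   : Reaches T σ
      gap       : ∃[ l ] (k ≤ toℕ l × orig d l ∉ σ)

  Gamma≐Stage₀ : ∀ T → Gamma d T ≐ Stage T 0
  Gamma≐Stage₀ T = to , from
    where
    to : ∀ {σ} → Gamma d T σ → Stage T 0 σ
    to (noNew , j , j∈T , j∉σ) =
      stage (λ i _ → noNew i) (λ _ ()) (j , j∈T , j∉σ , λ i _ → noNew i) (j , z≤n , j∉σ)
    from : ∀ {σ} → Stage T 0 σ → Gamma d T σ
    from (stage unborn _ (j , j∈T , j∉σ , _) _) = (λ i → unborn i z≤n) , j , j∈T , j∉σ

  Fset⊈⇒gap : ∀ {i σ} → ¬ (Fset d i ⊆ σ) → ∃[ l ] (toℕ i < toℕ l × orig d l ∉ σ)
  Fset⊈⇒gap F⊈σ with ⊈⇒∃∉ F⊈σ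
  ... | x , x∈F , x∉σ with vertex x
  ...   | old l = l , orig∈Fset⁻ x∈F , x∉σ
  ...   | new j = contradiction x∈F newv∉Fset

  gap⇒Fset⊈ : ∀ {i σ} → ∃[ l ] (toℕ i < toℕ l × orig d l ∉ σ) → ¬ (Fset d i ⊆ σ)
  gap⇒Fset⊈ (l , i<l , l∉σ) F⊆σ = l∉σ (F⊆σ (orig∈Fset⁺ i<l))

  newv≢ : ∀ {i j} → toℕ i ≢ toℕ j → newv d i ≢ newv d j
  newv≢ i≢j = i≢j ∘ cong toℕ ∘ newv-injective

  module _ {T : Subset (suc (suc d))} {i : Fin (suc d)} where

    private
      k : ℕ
      k = toℕ i
      F : Subset (Amb d)
      F = Fset d i
      v : Fin (Amb d)
      v = newv d i

    Stage⇒Stage-suc : ∀ {σ} → Stage T k σ → ¬ (F ⊆ σ) → Stage T (suc k) σ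
    Stage⇒Stage-suc {σ} (stage unborn antipodal reaches _) F⊈σ =
      stage (λ j → unborn j ∘ <⇒≤) antipodal′ reaches (Fset⊈⇒gap F⊈σ)
      where
      antipodal′ : ∀ j → toℕ j < suc k → orig d (inject₁ j) ∈ σ → newv d j ∉ σ
      antipodal′ j _ with toℕ j <? k
      ... | yes j<k = antipodal j j<k
      ... | no j≮k = λ _ → unborn j (≮⇒≥ j≮k)

    cone⇒Stage-suc : ∀ {σ} A B C → A ⊆ ⁅ v ⁆ → B ⊂ F → Link (Stage T k) F C → σ ≡ (A ∪ B) ∪ C →
                     Stage T (suc k) σ
    cone⇒Stage-suc {σ} A B C A⊆v (B⊆F , x , x∈F , x∉B)
      (C∩F≡∅ , stage unborn antipodal (r , r∈T , r∉C∪F , below) (l₀ , k≤l₀ , l₀∉C∪F)) σ≡ =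
      stage unborn′ antipodal′ reaches′ gap′
      where
      parts : ∀ {x} → x ∈ σ → x ≡ v ⊎ x ∈ B ⊎ x ∈ C
      parts = ∈-cone⁻ A⊆v σ≡
      C∌F : ∀ {x} → x ∈ C → x ∉ F
      C∌F x∈C x∈F = ∉⊥ (subst (_ ∈_) C∩F≡∅ (x∈p∩q⁺ (x∈C , x∈F)))
      ∉σ : ∀ {x} → x ≢ v → x ∉ C ∪ F → x ∉ σ
      ∉σ x≢v x∉C∪F x∈σ with parts x∈σ
      ... | inj₁ x≡v = x≢v x≡v
      ... | inj₂ (inj₁ x∈B) = x∉C∪F (x∈p∪q⁺ (inj₂ (B⊆F x∈B)))
      ... | inj₂ (inj₂ x∈C) = x∉C∪F (x∈p∪q⁺ (inj₁ x∈C))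
      ∉F⇒≤ : ∀ {l} → orig d l ∉ F → toℕ l ≤ k
      ∉F⇒≤ l∉F = ≮⇒≥ (l∉F ∘ orig∈Fset⁺)
      k∉C : ∀ l → toℕ l ≡ k → orig d l ∉ C
      k∉C l l≡k
        with toℕ-injective {i = l} {j = l₀} (trans l≡k (≤-antisym k≤l₀ (∉F⇒≤ (l₀∉C∪F ∘ x∈p∪q⁺ ∘ inj₂))))
      ...   | refl = l₀∉C∪F ∘ x∈p∪q⁺ ∘ inj₁
      unborn′ : ∀ j → suc k ≤ toℕ j → newv d j ∉ σ
      unborn′ j k<j = ∉σ (newv≢ λ j≡k → <-irrefl (sym j≡k) k<j) (unborn j (<⇒≤ k<j))
      antipodal′ : ∀ j → toℕ j < suc k → orig d (inject₁ j) ∈ σ → newv d j ∉ σ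
      antipodal′ j j≤k oj∈σ with parts oj∈σ
      ... | inj₁ oj≡v = contradiction oj≡v (orig≢newv _ _)
      ... | inj₂ (inj₁ oj∈B) =
        ⊥-elim (≤⇒≯ (≤-pred j≤k) (subst (k <_) (toℕ-inject₁ j) (orig∈Fset⁻ (B⊆F oj∈B))))
      ... | inj₂ (inj₂ oj∈C) with toℕ j <? k
      ...   | yes j<k = ∉σ (newv≢ (<⇒≢ j<k)) (antipodal j j<k (x∈p∪q⁺ (inj₁ oj∈C)))
      ...   | no j≮k =
        contradiction oj∈C (k∉C (inject₁ j) (trans (toℕ-inject₁ j) (≤-antisym (≤-pred j≤k) (≮⇒≥ j≮k))))
      reaches′ : Reaches T σ
      reaches′ = r , r∈T , ∉σ (orig≢newv _ _) r∉C∪F , λ l l<r →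
        ∉σ (newv≢ (<⇒≢ (<-≤-trans l<r (∉F⇒≤ (r∉C∪F ∘ x∈p∪q⁺ ∘ inj₂))))) (below l l<r)
      gap′ : ∃[ l ] (suc k ≤ toℕ l × orig d l ∉ σ)
      gap′ with vertex x
      ... | new j = contradiction x∈F newv∉Fset
      ... | old l =
        l , orig∈Fset⁻ x∈F , λ l∈σ → [ orig≢newv _ _ , [ x∉B , (λ l∈C → C∌F l∈C x∈F) ] ] (parts l∈σ)

    Stage-suc⇒Stage : ∀ {σ} → Stage T (suc k) σ → v ∉ σ → Stage T k σ
    Stage-suc⇒Stage {σ} (stage unborn antipodal reaches (l , k<l , l∉σ)) v∉σ =
      stage unborn′ (λ j j<k → antipodal j (<-trans j<k (n<1+n k))) reaches (l , <⇒≤ k<l , l∉σ)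
      where
      unborn′ : ∀ j → k ≤ toℕ j → newv d j ∉ σ
      unborn′ j k≤j with toℕ j ℕ.≟ k
      ... | no j≢k = unborn j (≤∧≢⇒< k≤j (j≢k ∘ sym))
      ... | yes j≡k with toℕ-injective j≡k
      ...   | refl = v∉σ

    Stage-suc⇒link : ∀ {σ} → Stage T (suc k) σ → v ∈ σ → Stage T k ((σ ∩ ∁ (⁅ v ⁆ ∪ F)) ∪ F)
    Stage-suc⇒link {σ} (stage unborn antipodal (r , r∈T , r∉σ , below) _) v∈σ =
      stage unborn′ antipodal′ (r , r∈T , r∉C∪F , λ j j<r → below j j<r ∘ proj₁ ∘ newv∈C∪F) gap′
      where
      C : Subset (Amb d)
      C = σ ∩ ∁ (⁅ v ⁆ ∪ F)
      C∪F⁻ : ∀ {x} → x ∈ C ∪ F → x ∈ F ⊎ (x ∈ σ × x ≢ v)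
      C∪F⁻ x∈C∪F with x∈p∪q⁻ _ _ x∈C∪F
      ... | inj₂ x∈F = inj₁ x∈F
      ... | inj₁ x∈C with x∈p∩q⁻ _ _ x∈C
      ...   | x∈σ , x∈∁ = inj₂ (x∈σ , λ { refl → x∈∁p⇒x∉p x∈∁ (x∈p∪q⁺ (inj₁ (x∈⁅x⁆ v))) })
      newv∈C∪F : ∀ {j} → newv d j ∈ C ∪ F → newv d j ∈ σ × j ≢ i
      newv∈C∪F vj∈C∪F with C∪F⁻ vj∈C∪F
      ... | inj₁ vj∈F = contradiction vj∈F newv∉Fset
      ... | inj₂ (vj∈σ , vj≢v) = vj∈σ , vj≢v ∘ cong (newv d)
      orig∈C∪F : ∀ {l} → orig d l ∈ C ∪ F → toℕ l ≤ k → orig d l ∈ σ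
      orig∈C∪F ol∈C∪F l≤k with C∪F⁻ ol∈C∪F
      ... | inj₁ ol∈F = contradiction (orig∈Fset⁻ ol∈F) (≤⇒≯ l≤k)
      ... | inj₂ (ol∈σ , _) = ol∈σ
      unborn′ : ∀ j → k ≤ toℕ j → newv d j ∉ C ∪ F
      unborn′ j k≤j vj∈C∪F with newv∈C∪F vj∈C∪F
      ... | vj∈σ , j≢i = unborn j (≤∧≢⇒< k≤j (j≢i ∘ toℕ-injective ∘ sym)) vj∈σ
      antipodal′ : ∀ j → toℕ j < k → orig d (inject₁ j) ∈ C ∪ F → newv d j ∉ C ∪ F
      antipodal′ j j<k oj∈C∪F vj∈C∪F =
        antipodal j (<-trans j<k (n<1+n k))
          (orig∈C∪F oj∈C∪F (subst (_≤ k) (sym (toℕ-inject₁ j)) (<⇒≤ j<k)))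
          (proj₁ (newv∈C∪F vj∈C∪F))
      -- v ∈ σ rules out r > k, which would put orig r in F.
      r∉C∪F : orig d r ∉ C ∪ F
      r∉C∪F or∈C∪F with C∪F⁻ or∈C∪F
      ... | inj₁ or∈F = below i (orig∈Fset⁻ or∈F) v∈σ
      ... | inj₂ (or∈σ , _) = r∉σ or∈σ
      gap′ : ∃[ l ] (k ≤ toℕ l × orig d l ∉ C ∪ F)
      gap′ = inject₁ i , ≤-reflexive (sym (toℕ-inject₁ i)) , λ oi∈C∪F →
        antipodal i (n<1+n k) (orig∈C∪F oi∈C∪F (≤-reflexive (toℕ-inject₁ i))) v∈σ

    Stage-suc⇒Stellar : ∀ {σ} → Stage T (suc k) σ → Stellar F v (Stage T k) σ
    Stage-suc⇒Stellar {σ} st with v ∈? σ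
    ... | no v∉σ = inj₁ (Stage-suc⇒Stage st v∉σ , gap⇒Fset⊈ (Stage.gap st))
    ... | yes v∈σ = inj₂ (σ ∩ ⁅ v ⁆ , σ ∩ F , σ ∩ ∁ (⁅ v ⁆ ∪ F) , p∩q⊆q _ _ , σ∩F⊂F (Stage.gap st) ,
                          (∩-∁-∪-disjoint σ ⁅ v ⁆ F , Stage-suc⇒link st v∈σ) , ∩-partition σ ⁅ v ⁆ F)
      where
      σ∩F⊂F : ∃[ l ] (suc k ≤ toℕ l × orig d l ∉ σ) → σ ∩ F ⊂ F
      σ∩F⊂F (l , k<l , l∉σ) = p∩q⊆q _ _ , orig d l , orig∈Fset⁺ k<l , l∉σ ∘ proj₁ ∘ x∈p∩q⁻ _ _

    Stellar≐Stage-suc : Stellar F v (Stage T k) ≐ Stage T (suc k)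
    Stellar≐Stage-suc = to , Stage-suc⇒Stellar
      where
      to : ∀ {σ} → Stellar F v (Stage T k) σ → Stage T (suc k) σ
      to (inj₁ (st , F⊈σ)) = Stage⇒Stage-suc st F⊈σ
      to (inj₂ (A , B , C , A⊆v , B⊂F , link , σ≡)) = cone⇒Stage-suc A B C A⊆v B⊂F link σ≡

  subdivide : Cx (Amb d) → Fin (suc d) → Cx (Amb d)
  subdivide K i = Stellar (Fset d i) (newv d i) K

  foldl-subdivide≐Stage : ∀ {T K} c m (f : Fin m → Fin (suc d)) → (∀ x → toℕ (f x) ≡ c + toℕ x) →
                          K ≐ Stage T c → foldl subdivide K (tabulateList f) ≐ Stage T (c + m)
  foldl-subdivide≐Stage {T} c zero f _ K≐ = subst (λ k → _ ≐ Stage T k) (sym (+-identityʳ c)) K≐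
  foldl-subdivide≐Stage {T} {K} c (suc m) f f≡ K≐ =
    subst (λ k → foldl subdivide K (tabulateList f) ≐ Stage T k) (sym (+-suc c m))
      (foldl-subdivide≐Stage (suc c) m (f ∘ suc) (λ x → trans (f≡ (suc x)) (+-suc c (toℕ x)))
        (≐-trans (Stellar-cong (Fset d (f zero)) (newv d (f zero)) K≐) step))
    where
    step : subdivide (Stage T c) (f zero) ≐ Stage T (suc c)
    step = subst (λ k → subdivide (Stage T k) (f zero) ≐ Stage T (suc k))
                 (trans (f≡ zero) (+-identityʳ c)) Stellar≐Stage-suc

  record CrossFace (σ : Subset (Amb d)) : Set where
    constructor crossFace
    field
      top∉      : orig d top ∉ σ
      antipodal : ∀ i → orig d (inject₁ i) ∈ σ → newv d i ∉ σ

  DiamondFace : Subset (suc (suc d)) → Cx (Amb d)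
  DiamondFace T σ = CrossFace σ × Reaches T σ

  Stage≐DiamondFace : ∀ {T} → Stage T (suc d) ≐ DiamondFace T
  Stage≐DiamondFace {T} = to , from
    where
    to : ∀ {σ} → Stage T (suc d) σ → DiamondFace T σ
    to {σ} (stage _ antipodal reaches (l , d<l , l∉σ)) =
      crossFace (subst (λ l → orig d l ∉ σ) l≡top l∉σ) (λ i → antipodal i (toℕ<n i)) , reaches
      where
      l≡top : l ≡ top
      l≡top = toℕ-injective (trans (≤-antisym (≤-pred (toℕ<n l)) d<l) (sym (toℕ-fromℕ (suc d))))
    from : ∀ {σ} → DiamondFace T σ → Stage T (suc d) σ
    from (crossFace top∉ antipodal , reaches) =
      stage (λ i d<i → contradiction (toℕ<n i) (≤⇒≯ d<i)) (λ i _ → antipodal i) reaches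
            (top , ≤-reflexive (sym (toℕ-fromℕ (suc d))) , top∉)

  Diamond≐DiamondFace : ∀ T → Diamond d T ≐ DiamondFace T
  Diamond≐DiamondFace T =
    ≐-trans (foldl-subdivide≐Stage 0 (suc d) (λ x → x) (λ _ → refl) (Gamma≐Stage₀ T)) Stage≐DiamondFace

-- Isomorphisms of complexes

module _ {N : ℕ} where

  ∈-img⁺ : ∀ (π : Permutation′ N) {σ x} → π ⟨$⟩ˡ x ∈ σ → x ∈ img π σ
  ∈-img⁺ π {x = x} πx∈σ = lookup⇒∈ (trans (lookup∘tabulate _ x) (∈⇒lookup πx∈σ))

  ∈-img⁻ : ∀ (π : Permutation′ N) {σ x} → x ∈ img π σ → π ⟨$⟩ˡ x ∈ σ
  ∈-img⁻ π {x = x} x∈πσ = lookup⇒∈ (trans (sym (lookup∘tabulate _ x)) (∈⇒lookup x∈πσ))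

  img-mono : ∀ (π : Permutation′ N) {σ τ} → σ ⊆ τ → img π σ ⊆ img π τ
  img-mono π σ⊆τ = ∈-img⁺ π ∘ σ⊆τ ∘ ∈-img⁻ π

  img-flip-inverseˡ : ∀ (π : Permutation′ N) σ → img (Perm.flip π) (img π σ) ≡ σ
  img-flip-inverseˡ π σ = ⊆-antisym
    (λ x∈ → subst (_∈ σ) (Perm.inverseˡ π) (∈-img⁻ π (∈-img⁻ (Perm.flip π) x∈)))
    (λ x∈σ → ∈-img⁺ (Perm.flip π) (∈-img⁺ π (subst (_∈ σ) (sym (Perm.inverseˡ π)) x∈σ)))

  img-flip-inverseʳ : ∀ (π : Permutation′ N) σ → img π (img (Perm.flip π) σ) ≡ σ
  img-flip-inverseʳ π σ = ⊆-antisym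
    (λ x∈ → subst (_∈ σ) (Perm.inverseʳ π) (∈-img⁻ (Perm.flip π) (∈-img⁻ π x∈)))
    (λ x∈σ → ∈-img⁺ π (∈-img⁺ (Perm.flip π) (subst (_∈ σ) (sym (Perm.inverseʳ π)) x∈σ)))

  img-injective : ∀ (π : Permutation′ N) {σ σ′} → img π σ ≡ img π σ′ → σ ≡ σ′
  img-injective π {σ} {σ′} eq =
    trans (sym (img-flip-inverseˡ π σ)) (trans (cong (img (Perm.flip π)) eq) (img-flip-inverseˡ π σ′))

  Iso-refl : ∀ {K : Cx N} → Iso K K
  Iso-refl {K} = Perm.id , λ σ → subst K (sym (tabulate∘lookup σ)) , subst K (tabulate∘lookup σ)

  Iso-sym : ∀ {K L : Cx N} → Iso K L → Iso L K
  Iso-sym {K} {L} (π , K⇔L) = Perm.flip π , λ τ →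
    (λ Lτ → proj₂ (K⇔L _) (subst L (sym (img-flip-inverseʳ π τ)) Lτ)) ,
    (λ Kπ⁻¹τ → subst L (img-flip-inverseʳ π τ) (proj₁ (K⇔L _) Kπ⁻¹τ))

  Iso-≐ : ∀ {K K′ L L′ : Cx N} → K ≐ K′ → L ≐ L′ → Iso K L → Iso K′ L′
  Iso-≐ (K⊆K′ , K′⊆K) (L⊆L′ , L′⊆L) (π , K⇔L) = π , λ σ →
    L⊆L′ ∘ proj₁ (K⇔L σ) ∘ K′⊆K , K⊆K′ ∘ proj₂ (K⇔L σ) ∘ L′⊆L

  ∈-img-≡ : ∀ (π : Permutation′ N) {σ x y} → π ⟨$⟩ˡ x ≡ y → x ∈ img π σ ⇔ y ∈ σ
  ∈-img-≡ π πx≡y = mk⇔ (subst (_∈ _) πx≡y ∘ ∈-img⁻ π) (∈-img⁺ π ∘ subst (_∈ _) (sym πx≡y))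

  Maximal : Cx N → Subset N → Set
  Maximal K σ = K σ × ∀ {τ} → K τ → σ ⊆ τ → τ ⊆ σ

  Iso-Maximal : ∀ {K L : Cx N} ((π , _) : Iso K L) {σ} → Maximal K σ → Maximal L (img π σ)
  Iso-Maximal {K} {L} (π , K⇔L) {σ} (Kσ , σ-max) = proj₁ (K⇔L σ) Kσ , πσ-max
    where
    πσ-max : ∀ {τ} → L τ → img π σ ⊆ τ → τ ⊆ img π σ
    πσ-max {τ} Lτ πσ⊆τ = subst (_⊆ img π σ) (img-flip-inverseʳ π τ) (img-mono π (σ-max Kπ⁻¹τ σ⊆π⁻¹τ))
      where
      Kπ⁻¹τ : K (img (Perm.flip π) τ)
      Kπ⁻¹τ = proj₂ (K⇔L _) (subst L (sym (img-flip-inverseʳ π τ)) Lτ)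
      σ⊆π⁻¹τ : σ ⊆ img (Perm.flip π) τ
      σ⊆π⁻¹τ = subst (_⊆ img (Perm.flip π) τ) (img-flip-inverseˡ π σ) (img-mono (Perm.flip π) πσ⊆τ)

-- Reduction to Γ not containing the facet opposite to d+1

module _ {d : ℕ} where

  CrossFace-reach : ∀ {σ} → CrossFace σ → ∀ l → (∀ i → toℕ i < l → newv d i ∉ σ) → l ≤ suc d →
                    ∃[ j ] (l ≤ toℕ j × orig d j ∉ σ × ∀ i → toℕ i < toℕ j → newv d i ∉ σ)
  CrossFace-reach {σ} (crossFace top∉ antipodal) l below l≤d+1
    with minimal-counterexample (λ j → (l ≤? toℕ j) →-dec (orig d j ∈? σ))
           (λ all → top∉ (all top (subst (l ≤_) (sym (toℕ-fromℕ (suc d))) l≤d+1)))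
  ... | j , ¬Pj , minimal = j , l≤j , (λ j∈σ → ¬Pj λ _ → j∈σ) , below-j
    where
    l≤j : l ≤ toℕ j
    l≤j = decidable-stable (l ≤? toℕ j) (λ l≰j → ¬Pj (⊥-elim ∘ l≰j))
    below-j : ∀ i → toℕ i < toℕ j → newv d i ∉ σ
    below-j i i<j with toℕ i <? l
    ... | yes i<l = below i i<l
    ... | no i≮l = antipodal i (minimal (inject₁ i) (subst (_< toℕ j) (sym (toℕ-inject₁ i)) i<j)
                                        (subst (l ≤_) (sym (toℕ-inject₁ i)) (≮⇒≥ i≮l)))

  collapsed : Fin (suc d) → Subset (suc (suc d)) → Fin (suc (suc d)) → Bool
  collapsed m T j with <-cmp (toℕ j) (toℕ m)
  ... | tri< _ _ _ = lookup T j
  ... | tri≈ _ _ _ = true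
  ... | tri> _ _ _ = false

  collapse : Fin (suc d) → Subset (suc (suc d)) → Subset (suc (suc d))
  collapse m T = tabulate (collapsed m T)

  module _ {m : Fin (suc d)} {T : Subset (suc (suc d))} where

    ∈-collapse-below : ∀ {j} → toℕ j < toℕ m → j ∈ collapse m T ⇔ j ∈ T
    ∈-collapse-below {j} j<m = lookup≡⇒∈⇔ lookup≡
      where
      lookup≡ : lookup (collapse m T) j ≡ lookup T j
      lookup≡ rewrite lookup∘tabulate (collapsed m T) j with <-cmp (toℕ j) (toℕ m)
      ... | tri< _ _ _ = refl
      ... | tri≈ j≮m _ _ = contradiction j<m j≮m
      ... | tri> j≮m _ _ = contradiction j<m j≮m

    m∈collapse : inject₁ m ∈ collapse m T
    m∈collapse = lookup⇒∈ lookup≡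
      where
      lookup≡ : lookup (collapse m T) (inject₁ m) ≡ true
      lookup≡ rewrite lookup∘tabulate (collapsed m T) (inject₁ m) with <-cmp (toℕ (inject₁ m)) (toℕ m)
      ... | tri≈ _ _ _ = refl
      ... | tri< _ m≢m _ = contradiction (toℕ-inject₁ m) m≢m
      ... | tri> _ m≢m _ = contradiction (toℕ-inject₁ m) m≢m

    ∉-collapse-above : ∀ {j} → toℕ m < toℕ j → j ∉ collapse m T
    ∉-collapse-above {j} m<j j∈ = contradiction (trans (sym lookup≡) (∈⇒lookup j∈)) λ ()
      where
      lookup≡ : lookup (collapse m T) j ≡ false
      lookup≡ rewrite lookup∘tabulate (collapsed m T) j with <-cmp (toℕ j) (toℕ m)
      ... | tri> _ _ _ = refl
      ... | tri< _ _ j≯m = contradiction m<j j≯m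
      ... | tri≈ _ _ j≯m = contradiction m<j j≯m

  module _ (m : Fin (suc d)) where

    swap : Permutation′ (Amb d)
    swap = Perm.transpose (orig d (inject₁ m)) (newv d m)

    private
      module _ {σ : Subset (Amb d)} where
        ∈-swap-orig : orig d (inject₁ m) ∈ img swap σ ⇔ newv d m ∈ σ
        ∈-swap-orig = ∈-img-≡ swap (transpose-matchʳ (newv d m) (orig d (inject₁ m)))

        ∈-swap-newv : newv d m ∈ img swap σ ⇔ orig d (inject₁ m) ∈ σ
        ∈-swap-newv = ∈-img-≡ swap (transpose-matchˡ (newv d m) (orig d (inject₁ m)))

        ∈-swap-orig-other : ∀ {j} → toℕ j ≢ toℕ m → orig d j ∈ img swap σ ⇔ orig d j ∈ σ
        ∈-swap-orig-other j≢m = ∈-img-≡ swap (transpose-other (orig≢newv _ _)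
          (λ j≡m → j≢m (trans (cong toℕ (orig-injective j≡m)) (toℕ-inject₁ m))))

        ∈-swap-newv-other : ∀ {i} → toℕ i ≢ toℕ m → newv d i ∈ img swap σ ⇔ newv d i ∈ σ
        ∈-swap-newv-other i≢m = ∈-img-≡ swap (transpose-other (newv≢ i≢m) (orig≢newv _ _ ∘ sym))

      top≢m : toℕ (top {d}) ≢ toℕ m
      top≢m top≡m = <-irrefl (trans (sym top≡m) (toℕ-fromℕ (suc d))) (toℕ<n m)

    CrossFace-swap : ∀ {σ} → CrossFace σ → CrossFace (img swap σ)
    CrossFace-swap {σ} (crossFace top∉ antipodal) =
      crossFace (top∉ ∘ Equivalence.to (∈-swap-orig-other top≢m)) antipodal′
      where
      antipodal′ : ∀ i → orig d (inject₁ i) ∈ img swap σ → newv d i ∉ img swap σ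
      antipodal′ i with toℕ i ℕ.≟ toℕ m
      ... | yes i≡m with toℕ-injective i≡m
      ...   | refl = λ oi∈ vi∈ →
        antipodal i (Equivalence.to ∈-swap-newv vi∈) (Equivalence.to ∈-swap-orig oi∈)
      antipodal′ i | no i≢m = λ oi∈ vi∈ →
        antipodal i (Equivalence.to (∈-swap-orig-other (i≢m ∘ trans (sym (toℕ-inject₁ i)))) oi∈)
                    (Equivalence.to (∈-swap-newv-other i≢m) vi∈)

    CrossFace-unswap : ∀ {σ} → CrossFace (img swap σ) → CrossFace σ
    CrossFace-unswap {σ} (crossFace top∉ antipodal) =
      crossFace (top∉ ∘ Equivalence.from (∈-swap-orig-other top≢m)) antipodal′
      where
      antipodal′ : ∀ i → orig d (inject₁ i) ∈ σ → newv d i ∉ σ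
      antipodal′ i with toℕ i ℕ.≟ toℕ m
      ... | yes i≡m with toℕ-injective i≡m
      ...   | refl = λ oi∈ vi∈ →
        antipodal i (Equivalence.from ∈-swap-orig vi∈) (Equivalence.from ∈-swap-newv oi∈)
      antipodal′ i | no i≢m = λ oi∈ vi∈ →
        antipodal i (Equivalence.from (∈-swap-orig-other (i≢m ∘ trans (sym (toℕ-inject₁ i)))) oi∈)
                    (Equivalence.from (∈-swap-newv-other i≢m) vi∈)

    module _ {T : Subset (suc (suc d))} (m∉T : inject₁ m ∉ T) (above∈T : ∀ j → toℕ m < toℕ j → j ∈ T) where

      Reaches-swap : ∀ {σ} → Reaches T σ → Reaches (collapse m T) (img swap σ)
      Reaches-swap (j , j∈T , j∉σ , below) with <-cmp (toℕ j) (toℕ m)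
      ... | tri< j<m _ _ =
        j , Equivalence.from (∈-collapse-below j<m) j∈T ,
        j∉σ ∘ Equivalence.to (∈-swap-orig-other (<⇒≢ j<m)) ,
        λ i i<j → below i i<j ∘ Equivalence.to (∈-swap-newv-other (<⇒≢ (<-trans i<j j<m)))
      ... | tri≈ _ j≡m _ =
        contradiction (subst (_∈ T) (toℕ-injective (trans j≡m (sym (toℕ-inject₁ m)))) j∈T) m∉T
      ... | tri> _ _ m<j =
        inject₁ m , m∈collapse , below m m<j ∘ Equivalence.to ∈-swap-orig , λ i i<m →
          let i<m′ = subst (toℕ i <_) (toℕ-inject₁ m) i<m in
          below i (<-trans i<m′ m<j) ∘ Equivalence.to (∈-swap-newv-other (<⇒≢ i<m′))

      -- Below m nothing changes; reaching T through m itself is replaced by reaching the run of T above m.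
      Reaches-unswap : ∀ {σ} → CrossFace σ → Reaches (collapse m T) (img swap σ) → Reaches T σ
      Reaches-unswap {σ} cf (j , j∈c , j∉σ′ , below′) with <-cmp (toℕ j) (toℕ m)
      ... | tri< j<m _ _ =
        j , Equivalence.to (∈-collapse-below j<m) j∈c ,
        j∉σ′ ∘ Equivalence.from (∈-swap-orig-other (<⇒≢ j<m)) ,
        λ i i<j → below′ i i<j ∘ Equivalence.from (∈-swap-newv-other (<⇒≢ (<-trans i<j j<m)))
      ... | tri> _ _ m<j = contradiction j∈c (∉-collapse-above m<j)
      ... | tri≈ _ j≡m _ with toℕ-injective (trans j≡m (sym (toℕ-inject₁ m)))
      ...   | refl with CrossFace-reach cf (suc (toℕ m)) below-m (toℕ<n m)
        where
        below-m : ∀ i → toℕ i < suc (toℕ m) → newv d i ∉ σ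
        below-m i i≤m with toℕ i ℕ.≟ toℕ m
        ... | yes i≡m with toℕ-injective i≡m
        ...   | refl = j∉σ′ ∘ Equivalence.from ∈-swap-orig
        below-m i i≤m | no i≢m =
          below′ i (subst (toℕ i <_) (sym (toℕ-inject₁ m)) (≤∧≢⇒< (≤-pred i≤m) i≢m))
            ∘ Equivalence.from (∈-swap-newv-other i≢m)
      ...     | r , m<r , r∉σ , below-r = r , above∈T r m<r , r∉σ , below-r

      Iso-collapse : Iso (DiamondFace T) (DiamondFace (collapse m T))
      Iso-collapse = swap , λ σ →
        (λ (cf , r) → CrossFace-swap cf , Reaches-swap r) ,
        (λ (cf′ , r′) → CrossFace-unswap cf′ , Reaches-unswap (CrossFace-unswap cf′) r′)

  Canonical : Subset (suc (suc d)) → Set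
  Canonical c = top ∉ c × ∃[ i ] (inject₁ i ∈ c)

  ∃-inject₁∈ : ∀ {T : Subset (suc (suc d))} {j} → top ∉ T → j ∈ T → ∃[ i ] (inject₁ i ∈ T)
  ∃-inject₁∈ {j = j} top∉T j∈T with view j
  ... | ‵fromℕ = contradiction j∈T top∉T
  ... | ‵inject₁ i = i , j∈T

  canonical-form : ∀ T → Admissible T → ∃[ c ] (Canonical c × Iso (DiamondFace T) (DiamondFace c))
  canonical-form T ((j , j∈T) , (j′ , j′∉T)) with top ∈? T
  ... | no top∉T = T , (top∉T , ∃-inject₁∈ top∉T j∈T) , Iso-refl
  ... | yes top∈T with maximal-counterexample (_∈? T) (λ all∈T → j′∉T (all∈T j′))
  ...   | m , m∉T , above with view m
  ...     | ‵fromℕ = contradiction top∈T m∉T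
  ...     | ‵inject₁ m′ =
    collapse m′ T , (∉-collapse-above m′<top , m′ , m∈collapse) , Iso-collapse m′ m∉T above′
    where
    m′<top : toℕ m′ < toℕ (top {d})
    m′<top = subst (toℕ m′ <_) (sym (toℕ-fromℕ (suc d))) (toℕ<n m′)
    above′ : ∀ j → toℕ m′ < toℕ j → j ∈ T
    above′ j m′<j = above j (subst (_< toℕ j) (sym (toℕ-inject₁ m′)) m′<j)

-- Counting words by their least element

-- 2 ^ k, computed so that Fin (pow2 (suc k)) splits as Fin (pow2 k) ⊎ Fin (pow2 k).
pow2 : ℕ → ℕ
pow2 zero = 1
pow2 (suc k) = pow2 k + pow2 k

pow2≡2^ : ∀ k → pow2 k ≡ 2 ^ k
pow2≡2^ zero = refl
pow2≡2^ (suc k) = cong₂ _+_ (pow2≡2^ k) (trans (pow2≡2^ k) (sym (+-identityʳ (2 ^ k))))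

-- bs read as a binary numeral, most significant digit first.
value : Subset n → ℕ
value [] = 0
value {suc n} (b ∷ bs) = (if b then pow2 n else 0) + value bs

value< : ∀ (bs : Subset n) → value bs < pow2 n
value< [] = s≤s z≤n
value< {suc n} (b ∷ bs) = +-mono-≤-< (digit≤ b) (value< bs)
  where
  digit≤ : ∀ b → (if b then pow2 n else 0) ≤ pow2 n
  digit≤ true = ≤-refl
  digit≤ false = z≤n

value-injective : ∀ {bs cs : Subset n} → value bs ≡ value cs → bs ≡ cs
value-injective {bs = []} {[]} _ = refl
value-injective {suc n} {true ∷ bs} {true ∷ cs} eq =
  cong (true ∷_) (value-injective (+-cancelˡ-≡ (pow2 n) _ _ eq))
value-injective {suc n} {false ∷ bs} {false ∷ cs} eq = cong (false ∷_) (value-injective eq)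
value-injective {suc n} {true ∷ bs} {false ∷ cs} eq =
  contradiction (≤-trans (m≤m+n (pow2 n) (value bs)) (≤-reflexive eq)) (<⇒≱ (value< cs))
value-injective {suc n} {false ∷ bs} {true ∷ cs} eq =
  contradiction (≤-trans (m≤m+n (pow2 n) (value cs)) (≤-reflexive (sym eq))) (<⇒≱ (value< bs))

pow2>0 : ∀ k → 0 < pow2 k
pow2>0 zero = s≤s z≤n
pow2>0 (suc k) = ≤-trans (pow2>0 k) (m≤m+n (pow2 k) (pow2 k))

∈⇒value>0 : ∀ {bs : Subset n} {i} → i ∈ bs → 0 < value bs
∈⇒value>0 {suc n} {bs = _ ∷ bs} here = ≤-trans (pow2>0 n) (m≤m+n (pow2 n) (value bs))
∈⇒value>0 {suc n} {bs = b ∷ _} (there i∈bs) = ≤-trans (∈⇒value>0 i∈bs) (m≤n+m _ (if b then pow2 n else 0))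

value>0⇒∃∈ : ∀ {bs : Subset n} → 0 < value bs → ∃[ i ] (i ∈ bs)
value>0⇒∃∈ {bs = true ∷ _} _ = zero , here
value>0⇒∃∈ {bs = false ∷ _} v>0 = let i , i∈bs = value>0⇒∃∈ v>0 in suc i , there i∈bs

fromValue : ∀ n m → m < pow2 n → ∃[ bs ] (value {n} bs ≡ m)
fromValue zero m m<1 = [] , sym (n<1⇒n≡0 m<1)
fromValue (suc n) m m<2p with pow2 n ≤? m
... | no p≰m = let bs , v≡m = fromValue n m (≰⇒> p≰m) in false ∷ bs , v≡m
... | yes p≤m = let bs , v≡m∸p = fromValue n (m ∸ pow2 n) m∸p<p in
                true ∷ bs , trans (cong (pow2 n +_) v≡m∸p) (m+[n∸m]≡n p≤m)
  where
  m∸p<p : m ∸ pow2 n < pow2 n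
  m∸p<p = +-cancelˡ-< (pow2 n) _ _ (subst (_< pow2 n + pow2 n) (sym (m+[n∸m]≡n p≤m)) m<2p)

toBits : Fin (pow2 n) → Subset n
toBits {zero} _ = []
toBits {suc n} x = [ (true ∷_) ∘ toBits {n} , (false ∷_) ∘ toBits {n} ] (splitAt (pow2 n) x)

fromBits : Subset n → Fin (pow2 n)
fromBits [] = zero
fromBits {suc n} (true ∷ w) = fromBits w F.↑ˡ pow2 n
fromBits {suc n} (false ∷ w) = pow2 n F.↑ʳ fromBits w

toBits-fromBits : ∀ (w : Subset n) → toBits (fromBits w) ≡ w
toBits-fromBits [] = refl
toBits-fromBits {suc n} (true ∷ w) rewrite splitAt-↑ˡ (pow2 n) (fromBits w) (pow2 n) =
  cong (true ∷_) (toBits-fromBits w)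
toBits-fromBits {suc n} (false ∷ w) rewrite splitAt-↑ʳ (pow2 n) (pow2 n) (fromBits w) =
  cong (false ∷_) (toBits-fromBits w)

fromBits-toBits : ∀ (x : Fin (pow2 n)) → fromBits (toBits {n} x) ≡ x
fromBits-toBits {zero} zero = refl
fromBits-toBits {suc n} x with splitAt (pow2 n) x in eq
... | inj₁ y = trans (cong (F._↑ˡ pow2 n) (fromBits-toBits {n} y)) (splitAt⁻¹-↑ˡ eq)
... | inj₂ y = trans (cong (pow2 n F.↑ʳ_) (fromBits-toBits {n} y)) (splitAt⁻¹-↑ʳ eq)

toBits-injective : ∀ {x y : Fin (pow2 n)} → toBits {n} x ≡ toBits y → x ≡ y
toBits-injective {n} {x} {y} eq =
  trans (sym (fromBits-toBits {n} x)) (trans (cong fromBits eq) (fromBits-toBits {n} y))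

MinIn : Subset n → Subset n → Set
MinIn [] [] = ⊥
MinIn (b ∷ bs) (true ∷ w) = b ≡ true
MinIn (b ∷ bs) (false ∷ w) = MinIn bs w

MinIn⁺ : ∀ {bs w : Subset n} {i} → i ∈ bs → i ∈ w → (∀ j → j F.< i → j ∉ w) → MinIn bs w
MinIn⁺ {bs = _ ∷ _} {true ∷ _} {zero} here _ _ = refl
MinIn⁺ {bs = _ ∷ _} {true ∷ _} {suc _} _ _ below = contradiction here (below zero (s≤s z≤n))
MinIn⁺ {bs = _ ∷ _} {false ∷ _} {suc _} i∈bs i∈w below =
  MinIn⁺ (drop-there i∈bs) (drop-there i∈w) (λ j j<i → below (suc j) (s≤s j<i) ∘ there)

MinIn⁻ : ∀ {bs w : Subset n} → MinIn bs w → ∃[ i ] (i ∈ bs × i ∈ w × ∀ j → j F.< i → j ∉ w)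
MinIn⁻ {bs = []} {[]} ()
MinIn⁻ {bs = _ ∷ _} {true ∷ _} refl = zero , here , here , λ _ ()
MinIn⁻ {bs = _ ∷ _} {false ∷ _} q with MinIn⁻ q
... | i , i∈bs , i∈w , below =
  suc i , there i∈bs , there i∈w , λ { zero _ → λ () ; (suc j) (s≤s j<i) → below j j<i ∘ drop-there }

word : ∀ (bs : Subset n) → Fin (value bs) → Subset n
word {suc n} (true ∷ bs) x = [ (true ∷_) ∘ toBits {n} , (false ∷_) ∘ word bs ] (splitAt (pow2 n) x)
word (false ∷ bs) x = false ∷ word bs x

word-MinIn : ∀ (bs : Subset n) x → MinIn bs (word bs x)
word-MinIn {suc n} (true ∷ bs) x with splitAt (pow2 n) x
... | inj₁ _ = refl
... | inj₂ y = word-MinIn bs y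
word-MinIn (false ∷ bs) x = word-MinIn bs x

word-injective : ∀ (bs : Subset n) {x y} → word bs x ≡ word bs y → x ≡ y
word-injective {suc n} (true ∷ bs) {x} {y} eq
  with splitAt (pow2 n) x in eqx | splitAt (pow2 n) y in eqy
... | inj₁ x′ | inj₁ y′ =
  trans (sym (splitAt⁻¹-↑ˡ eqx))
        (trans (cong (F._↑ˡ value bs) (toBits-injective {n} (∷-injectiveʳ eq))) (splitAt⁻¹-↑ˡ eqy))
... | inj₂ x′ | inj₂ y′ =
  trans (sym (splitAt⁻¹-↑ʳ eqx))
        (trans (cong (pow2 n F.↑ʳ_) (word-injective bs (∷-injectiveʳ eq))) (splitAt⁻¹-↑ʳ eqy))
... | inj₁ _ | inj₂ _ with () ← ∷-injectiveˡ eq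
... | inj₂ _ | inj₁ _ with () ← ∷-injectiveˡ eq
word-injective (false ∷ bs) eq = word-injective bs (∷-injectiveʳ eq)

index : ∀ (bs w : Subset n) → MinIn bs w → Fin (value bs)
index [] [] ()
index {suc n} (true ∷ bs) (true ∷ w) _ = fromBits w F.↑ˡ value bs
index {suc n} (true ∷ bs) (false ∷ w) q = pow2 n F.↑ʳ index bs w q
index (false ∷ bs) (false ∷ w) q = index bs w q
index (false ∷ bs) (true ∷ w) ()

word-index : ∀ (bs w : Subset n) q → word bs (index bs w q) ≡ w
word-index [] [] ()
word-index {suc n} (true ∷ bs) (true ∷ w) _ rewrite splitAt-↑ˡ (pow2 n) (fromBits w) (value bs) =
  cong (true ∷_) (toBits-fromBits w)
word-index {suc n} (true ∷ bs) (false ∷ w) q rewrite splitAt-↑ʳ (pow2 n) (value bs) (index bs w q) =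
  cong (false ∷_) (word-index bs w q)
word-index (false ∷ bs) (false ∷ w) q = cong (false ∷_) (word-index bs w q)
word-index (false ∷ bs) (true ∷ w) ()

-- The facets of ◇(Γ) for Γ canonical

module _ {d : ℕ} where

  -- w records which of the antipodal pairs {i, v_i} contribute v_i.
  facet : Subset (suc d) → Subset (Amb d)
  facet w = vertexSet (lookup (∁ (w ∷ʳ true))) (lookup w)

  ∈-facet-orig : ∀ {w k} → orig d k ∈ facet w ⇔ k ∈ ∁ (w ∷ʳ true)
  ∈-facet-orig {w} {k} = lookup≡⇒∈⇔ (lookup-vertexSet-orig (lookup (∁ (w ∷ʳ true))) (lookup w) k)

  ∈-facet-newv : ∀ {w i} → newv d i ∈ facet w ⇔ i ∈ w
  ∈-facet-newv {w} {i} = lookup≡⇒∈⇔ (lookup-vertexSet-newv (lookup (∁ (w ∷ʳ true))) (lookup w) i)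

  module _ {w : Subset (suc d)} where

    top∉facet : orig d top ∉ facet w
    top∉facet top∈ = x∈∁p⇒x∉p (Equivalence.to (∈-facet-orig {w}) top∈) fromℕ∈∷ʳtrue

    orig∈facet⁺ : ∀ {i} → i ∉ w → orig d (inject₁ i) ∈ facet w
    orig∈facet⁺ i∉w = Equivalence.from ∈-facet-orig (x∉p⇒x∈∁p (i∉w ∘ Equivalence.to ∈-∷ʳ-inject₁))

    orig∈facet⁻ : ∀ {i} → orig d (inject₁ i) ∈ facet w → i ∉ w
    orig∈facet⁻ oi∈ = x∈∁p⇒x∉p (Equivalence.to ∈-facet-orig oi∈) ∘ Equivalence.from ∈-∷ʳ-inject₁

    CrossFace-facet : CrossFace (facet w)
    CrossFace-facet = crossFace top∉facet λ i oi∈ vi∈ → orig∈facet⁻ oi∈ (Equivalence.to ∈-facet-newv vi∈)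

    facet-maximal : ∀ {τ} → CrossFace τ → facet w ⊆ τ → τ ⊆ facet w
    facet-maximal {τ} (crossFace top∉ antipodal) w⊆τ {x} x∈τ with vertex x
    ... | new i with i ∈? w
    ...   | yes i∈w = Equivalence.from ∈-facet-newv i∈w
    ...   | no i∉w = contradiction x∈τ (antipodal i (w⊆τ (orig∈facet⁺ i∉w)))
    facet-maximal {τ} (crossFace top∉ antipodal) w⊆τ {x} x∈τ | old k with view k
    ...   | ‵fromℕ = contradiction x∈τ top∉
    ...   | ‵inject₁ i with i ∈? w
    ...     | yes i∈w = contradiction (w⊆τ (Equivalence.from ∈-facet-newv i∈w)) (antipodal i x∈τ)
    ...     | no i∉w = orig∈facet⁺ i∉w

  code : Subset (Amb d) → Subset (suc d)
  code τ = tabulate (λ i → lookup τ (newv d i))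

  ∈-code : ∀ {τ i} → i ∈ code τ ⇔ newv d i ∈ τ
  ∈-code {τ} {i} = lookup≡⇒∈⇔ (lookup∘tabulate (λ i → lookup τ (newv d i)) i)

  code-facet : ∀ w → code (facet w) ≡ w
  code-facet w = trans (tabulate-cong (lookup-vertexSet-newv _ (lookup w))) (tabulate∘lookup w)

  facet-injective : ∀ {w w′} → facet w ≡ facet w′ → w ≡ w′
  facet-injective {w} {w′} eq = trans (sym (code-facet w)) (trans (cong code eq) (code-facet w′))

  module _ {bs : Subset (suc d)} where

    private
      <-inject₁ : ∀ {i j : Fin (suc d)} → toℕ j < toℕ (inject₁ i) → j F.< i
      <-inject₁ {i} = subst (_ <_) (toℕ-inject₁ i)

    facet-Maximal : ∀ {w} → MinIn bs w → Maximal (DiamondFace (bs ∷ʳ false)) (facet w)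
    facet-Maximal {w} q with MinIn⁻ q
    ... | i , i∈bs , i∈w , below =
      (CrossFace-facet {w} , reaches) , λ (cf , _) → facet-maximal {w} cf
      where
      reaches : Reaches (bs ∷ʳ false) (facet w)
      reaches = inject₁ i , Equivalence.from ∈-∷ʳ-inject₁ i∈bs , (λ oi∈ → orig∈facet⁻ oi∈ i∈w) ,
                λ j j<i → below j (<-inject₁ j<i) ∘ Equivalence.to ∈-facet-newv

    -- A maximal face reaches T through some i ≤ d; adding v_i to its code gives a facet containing it.
    Maximal⇒facet : ∀ {τ} → Maximal (DiamondFace (bs ∷ʳ false)) τ → ∃[ w ] (MinIn bs w × facet w ≡ τ)
    Maximal⇒facet {τ} ((cf , j , j∈T , oj∉τ , below) , τ-max) with view j
    ... | ‵fromℕ = contradiction j∈T fromℕ∉∷ʳfalse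
    ... | ‵inject₁ i = w , q , ⊆-antisym (τ-max (CrossFace-facet {w} , reaches) τ⊆facet) τ⊆facet
      where
      w : Subset (suc d)
      w = code τ ∪ ⁅ i ⁆
      q : MinIn bs w
      q = MinIn⁺ (Equivalence.to ∈-∷ʳ-inject₁ j∈T) (x∈p∪q⁺ (inj₂ (x∈⁅x⁆ i))) λ l l<i l∈w →
        [ below l (subst (_ <_) (sym (toℕ-inject₁ i)) l<i) ∘ Equivalence.to (∈-code {τ}) ,
          (λ l∈⁅i⁆ → <-irrefl (cong toℕ (x∈⁅y⁆⇒x≡y i l∈⁅i⁆)) l<i) ] (x∈p∪q⁻ (code τ) _ l∈w)
      reaches : Reaches (bs ∷ʳ false) (facet w)
      reaches = proj₂ (proj₁ (facet-Maximal {w} q))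
      τ⊆facet : τ ⊆ facet w
      τ⊆facet {x} x∈τ with vertex x
      ... | new l = Equivalence.from (∈-facet-newv {w}) (x∈p∪q⁺ (inj₁ (Equivalence.from ∈-code x∈τ)))
      ... | old k with view k
      ...   | ‵fromℕ = contradiction x∈τ (CrossFace.top∉ cf)
      ...   | ‵inject₁ l = orig∈facet⁺ λ l∈w →
        [ CrossFace.antipodal cf l x∈τ ∘ Equivalence.to ∈-code ,
          (λ l∈⁅i⁆ → oj∉τ (subst (λ l → orig d (inject₁ l) ∈ τ) (x∈⁅y⁆⇒x≡y i l∈⁅i⁆) x∈τ)) ]
        (x∈p∪q⁻ _ _ l∈w)

  -- An isomorphism maps facets to facets injectively, and the facets are counted by value.
  value-mono : ∀ {bs bs′ : Subset (suc d)} → Iso (DiamondFace (bs ∷ʳ false)) (DiamondFace (bs′ ∷ʳ false)) →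
               value bs ≤ value bs′
  value-mono {bs} {bs′} iso@(π , _) = injective⇒≤ {f = f} f-injective
    where
    image : ∀ x → ∃[ w ] (MinIn bs′ w × facet w ≡ img π (facet (word bs x)))
    image x = Maximal⇒facet (Iso-Maximal iso (facet-Maximal (word-MinIn bs x)))
    w : Fin (value bs) → Subset (suc d)
    w x = proj₁ (image x)
    f : Fin (value bs) → Fin (value bs′)
    f x = index bs′ (w x) (proj₁ (proj₂ (image x)))
    word-f : ∀ x → word bs′ (f x) ≡ w x
    word-f x = word-index bs′ (w x) (proj₁ (proj₂ (image x)))
    f-injective : ∀ {x y} → f x ≡ f y → x ≡ y
    f-injective {x} {y} fx≡fy = word-injective bs (facet-injective (img-injective π (begin
      img π (facet (word bs x))  ≡⟨ sym (proj₂ (proj₂ (image x))) ⟩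
      facet (w x)                ≡⟨ cong facet wx≡wy ⟩
      facet (w y)                ≡⟨ proj₂ (proj₂ (image y)) ⟩
      img π (facet (word bs y))  ∎)))
      where
      open ≡-Reasoning
      wx≡wy : w x ≡ w y
      wx≡wy = begin
        w x            ≡⟨ sym (word-f x) ⟩
        word bs′ (f x) ≡⟨ cong (word bs′) fx≡fy ⟩
        word bs′ (f y) ≡⟨ word-f y ⟩
        w y            ∎

-- The classification

<∸1⇒suc< : ∀ {a m} → a < m ∸ 1 → suc a < m
<∸1⇒suc< {m = suc m} a<m = s≤s a<m

module _ {d : ℕ} where

  digits : (c : Fin (2 ^ suc d ∸ 1)) → ∃[ bs ] (value {suc d} bs ≡ suc (toℕ c))
  digits c = fromValue (suc d) (suc (toℕ c))
    (subst (suc (toℕ c) <_) (sym (pow2≡2^ (suc d))) (<∸1⇒suc< (toℕ<n c)))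

  representative : Fin (2 ^ suc d ∸ 1) → Subset (suc (suc d))
  representative c = proj₁ (digits c) ∷ʳ false

  representative-Admissible : ∀ c → Admissible (representative c)
  representative-Admissible c =
    (let i , i∈bs = value>0⇒∃∈ (subst (0 <_) (sym (proj₂ (digits c))) (s≤s z≤n))
     in inject₁ i , Equivalence.from ∈-∷ʳ-inject₁ i∈bs) ,
    (top , fromℕ∉∷ʳfalse)

  representative-distinct : ∀ c c′ → Iso (Diamond d (representative c)) (Diamond d (representative c′)) →
                            c ≡ c′
  representative-distinct c c′ iso = toℕ-injective (suc-injective (begin
    suc (toℕ c)                ≡⟨ sym (proj₂ (digits c)) ⟩
    value (proj₁ (digits c))   ≡⟨ ≤-antisym (value-mono iso′) (value-mono (Iso-sym iso′)) ⟩
    value (proj₁ (digits c′))  ≡⟨ proj₂ (digits c′) ⟩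
    suc (toℕ c′)               ∎))
    where
    open ≡-Reasoning
    iso′ : Iso (DiamondFace (representative c)) (DiamondFace (representative c′))
    iso′ = Iso-≐ (Diamond≐DiamondFace _) (Diamond≐DiamondFace _) iso

  canonical-representative : ∀ {T} → Canonical T → ∃[ c ] (representative c ≡ T)
  canonical-representative {T} (top∉T , _ , i∈T) with initLast T
  ... | bs , true , refl = contradiction fromℕ∈∷ʳtrue top∉T
  ... | bs , false , refl with value bs in v≡ | ∈⇒value>0 (Equivalence.to ∈-∷ʳ-inject₁ i∈T)
  ...   | suc m | _ = c , cong (_∷ʳ false) (value-injective (begin
    value (proj₁ (digits c))  ≡⟨ proj₂ (digits c) ⟩
    suc (toℕ c)               ≡⟨ cong suc (toℕ-fromℕ< m<) ⟩
    suc m                     ≡⟨ sym v≡ ⟩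
    value bs                  ∎))
    where
    open ≡-Reasoning
    m< : m < 2 ^ suc d ∸ 1
    m< = ∸-monoˡ-< {n = 1} (subst (suc m <_) (pow2≡2^ (suc d)) (subst (_< pow2 (suc d)) v≡ (value< bs)))
                           (s≤s z≤n)
    c : Fin (2 ^ suc d ∸ 1)
    c = fromℕ< m<

-- The count holds for d = 0 as well.
theorem4p3 : ∀ (d : ℕ) → 1 ≤ d →
    Σ (Fin (2 ^ suc d ∸ 1) → Subset (suc (suc d))) λ Ts →
      (∀ i → Admissible (Ts i))
      × (∀ i j → Iso (Diamond d (Ts i)) (Diamond d (Ts j)) → i ≡ j)
      × (∀ (T : Subset (suc (suc d))) → Admissible T →
           Σ (Fin (2 ^ suc d ∸ 1)) λ i → Iso (Diamond d T) (Diamond d (Ts i)))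
theorem4p3 d _ = representative , representative-Admissible , representative-distinct , classify
  where
  classify : ∀ T → Admissible T → ∃[ c ] Iso (Diamond d T) (Diamond d (representative c))
  classify T admissible with canonical-form T admissible
  ... | T′ , canonical , iso with canonical-representative canonical
  ...   | c , refl = c , Iso-≐ (≐-sym (Diamond≐DiamondFace T)) (≐-sym (Diamond≐DiamondFace T′)) iso
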